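{- For every integer $g\ge 1$ there exists a latin trade of genus $g$ which cannot be embedded in any group, and there exists another latin trade of genus $g$ which can be embedded in a cyclic group.
   Context: A partial latin square (PLS) is a finite set $P\subseteq R\times C\times S$ of triples (row, column, symbol) such that any two distinct triples of $P$ agree in at most one coordinate. A latin bitrade is a pair $(W,B)$ of non-empty PLS such that for each $(r,c,s)\in W$ (respectively $B$) there exist unique $r'\ne r$, $c'\ne c$, $s'\ne s$ with $(r',c,s)$, $(r,c',s)$, $(r,c,s')$ all in $B$ (respectively $W$). Then $W$ is a latin trade and $B$ a disjoint mate. The bitrade is connected if there are no latin bitrades $(W',B')$, $(W'',B'')$ with $W'\cap W''=\emptyset$, $W=W'\cup W''$, $B=B'\cup B''$. Let $R,C,S$ (taken pairwise disjoint) be the sets of rows, columns, symbols actually used. For a row $r$, let $\psi_r$ be the permutation of the symbols in row $r$ with $\psi_r(s)=s'$ iff $(r,c,s)\in W$ and $(r,c,s')\in B$ for some $c$; analogous permutations are defined for each column (of the symbols in that column) and each symbol (of the rows containing it). The bitrade is separated if every one of these permutations is a single cycle. A separated connected bitrade has genus $g=\tfrac12(2+|W|-|R|-|C|-|S|)$ (the genus of the orientable surface triangulated by the triples of $W$ and $B$ on vertex set $R\cup C\cup S$). A latin trade $W$ has genus $g$ if there is a disjoint mate $B$ with $(W,B)$ separated, connected, of genus $g$. A PLS $P$ embeds in a group $G$ if there are injections $f:R\to G$, $h:C\to G$, $k:S\to G$ with $f(r)h(c)=k(s)$ for all $(r,c,s)\in P$. -}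

module Defs where

open import Level using (Level; 0ℓ; Setω)
open import Data.Nat using (ℕ; zero; suc; _+_; _*_)
open import Data.Fin using (Fin; _≟_)
open import Data.Fin.Properties using (≡-decSetoid)
open import Data.Product using (Σ; ∃; ∃-syntax; _×_; _,_; proj₁; proj₂)
open import Data.Sum using (_⊎_)
open import Data.List using (List; []; _∷_; length; filter)
open import Data.List.Relation.Unary.Any using (any?)
open import Data.List.Relation.Unary.Unique.Propositional using (Unique)
open import Data.List.Membership.Propositional using (_∈_)
open import Data.Vec.Functional using ()
open import Data.List.Base using ()
open import Data.Fin.Base using ()
open import Data.Empty using (⊥)
open import Relation.Nullary using (¬_)
open import Relation.Binary.PropositionalEquality using (_≡_; _≢_)
open import Relation.Binary.Construct.Closure.ReflexiveTransitive using (Star)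
open import Algebra.Bundles using (Group)
import Data.List as L

-- Rows, columns and symbols are drawn
-- from the (disjoint, since differently typed) ambient sets Fin n,
-- Fin m, Fin k; the sets R, C, S of the paper are the elements of these
-- that are actually used.

module _ {n m k : ℕ} where

  Triple : Set
  Triple = Fin n × Fin m × Fin k

  row : Triple → Fin n
  row (r , c , s) = r

  col : Triple → Fin m
  col (r , c , s) = c

  sym : Triple → Fin k
  sym (r , c , s) = s

  IsPLS : List Triple → Set
  IsPLS P = Unique P ×
    (∀ {r r' c c' s s'} → (r , c , s) ∈ P → (r' , c' , s') ∈ P →
       (r ≡ r' × c ≡ c') ⊎ (r ≡ r' × s ≡ s') ⊎ (c ≡ c' × s ≡ s') →
       (r , c , s) ≡ (r' , c' , s'))

  NonEmpty : List Triple → Set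
  NonEmpty P = ∃[ t ] t ∈ P

  Mates : List Triple → List Triple → Set
  Mates X Y = ∀ {r c s} → (r , c , s) ∈ X →
    (∃[ r' ] (r' ≢ r × (r' , c , s) ∈ Y ×
       (∀ r'' → r'' ≢ r → (r'' , c , s) ∈ Y → r'' ≡ r'))) ×
    (∃[ c' ] (c' ≢ c × (r , c' , s) ∈ Y ×
       (∀ c'' → c'' ≢ c → (r , c'' , s) ∈ Y → c'' ≡ c'))) ×
    (∃[ s' ] (s' ≢ s × (r , c , s') ∈ Y ×
       (∀ s'' → s'' ≢ s → (r , c , s'') ∈ Y → s'' ≡ s')))

  IsBitrade : List Triple → List Triple → Set
  IsBitrade W B = NonEmpty W × NonEmpty B × IsPLS W × IsPLS B ×
                  Mates W B × Mates B W

  Disjoint : List Triple → List Triple → Set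
  Disjoint X Y = ∀ {t} → t ∈ X → t ∈ Y → ⊥

  IsUnion : List Triple → List Triple → List Triple → Set
  IsUnion Z X Y = ∀ t → (t ∈ Z → t ∈ X ⊎ t ∈ Y) × (t ∈ X ⊎ t ∈ Y → t ∈ Z)

  Connected : List Triple → List Triple → Set
  Connected W B = ¬ (Σ (List Triple) λ W' → Σ (List Triple) λ B' →
                     Σ (List Triple) λ W'' → Σ (List Triple) λ B'' →
                     IsBitrade W' B' × IsBitrade W'' B'' × Disjoint W' W'' ×
                     IsUnion W W' W'' × IsUnion B B' B'')

  ψrow : List Triple → List Triple → Fin n → Fin k → Fin k → Set
  ψrow W B r s s' = ∃[ c ] ((r , c , s) ∈ W × (r , c , s') ∈ B)

  ψcol : List Triple → List Triple → Fin m → Fin k → Fin k → Set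
  ψcol W B c s s' = ∃[ r ] ((r , c , s) ∈ W × (r , c , s') ∈ B)

  ψsym : List Triple → List Triple → Fin k → Fin n → Fin n → Set
  ψsym W B s r r' = ∃[ c ] ((r , c , s) ∈ W × (r' , c , s) ∈ B)

  SingleCycle : {A : Set} → (A → Set) → (A → A → Set) → Set
  SingleCycle D ψ = ∀ x y → D x → D y → Star ψ x y

  Separated : List Triple → List Triple → Set
  Separated W B =
    (∀ r → SingleCycle (λ s → ∃[ c ] ((r , c , s) ∈ W)) (ψrow W B r)) ×
    (∀ c → SingleCycle (λ s → ∃[ r ] ((r , c , s) ∈ W)) (ψcol W B c)) ×
    (∀ s → SingleCycle (λ r → ∃[ c ] ((r , c , s) ∈ W)) (ψsym W B s))

  usedRows : List Triple → List (Fin n)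
  usedRows W = filter (λ r → any? (λ t → r ≟ row t) W) (L.allFin n)

  usedCols : List Triple → List (Fin m)
  usedCols W = filter (λ c → any? (λ t → c ≟ col t) W) (L.allFin m)

  usedSyms : List Triple → List (Fin k)
  usedSyms W = filter (λ s → any? (λ t → s ≟ sym t) W) (L.allFin k)

  -- genus formula g = (2 + |W| - |R| - |C| - |S|)/2, written without
  -- subtraction or division
  GenusEq : List Triple → ℕ → Set
  GenusEq W g = 2 * g + length (usedRows W) + length (usedCols W)
                  + length (usedSyms W) ≡ 2 + length W

  HasGenus : List Triple → ℕ → Set
  HasGenus W g = ∃[ B ] (IsBitrade W B × Separated W B × Connected W B ×
                         GenusEq W g)

  -- embedding of a PLS in a group (injectivity only required on the
  -- rows / columns / symbols actually used)
  Embeds : ∀ {c ℓ} → List Triple → Group c ℓ → Set (c Level.⊔ ℓ)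
  Embeds P G = ∃[ f ] ∃[ h ] ∃[ κ ]
      (InjOn (λ r → ∃[ c ] ∃[ s ] ((r , c , s) ∈ P)) f ×
       InjOn (λ c → ∃[ r ] ∃[ s ] ((r , c , s) ∈ P)) h ×
       InjOn (λ s → ∃[ r ] ∃[ c ] ((r , c , s) ∈ P)) κ ×
       (∀ {r c s} → (r , c , s) ∈ P → (f r ∙ h c) ≈ κ s))
    where
    open Group G
    InjOn : {A : Set} → (A → Set) → (A → Carrier) → Set _
    InjOn D φ = ∀ x y → D x → D y → φ x ≈ φ y → x ≡ y

module _ {c ℓ} (G : Group c ℓ) where
  open Group G

  pow : Carrier → ℕ → Carrier
  pow a zero = ε
  pow a (suc j) = a ∙ pow a j

  IsCyclic : Set (c Level.⊔ ℓ)
  IsCyclic = ∃[ a ] (∀ x → ∃[ j ] (x ≈ pow a j ⊎ x ≈ pow a j ⁻¹))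

-- A latin trade of genus g not embeddable in any group (Setω record,
-- since it quantifies over groups of all universe levels)

record NonEmbeddableTrade (g : ℕ) : Setω where
  field
    n m k : ℕ
    W : List (Triple {n} {m} {k})
    genus : HasGenus W g
    noEmbedding : ∀ {c ℓ} (G : Group c ℓ) → ¬ Embeds W G

record CyclicEmbeddableTrade (g : ℕ) : Set₁ where
  field
    n m k : ℕ
    W : List (Triple {n} {m} {k})
    genus : HasGenus W g
    G : Group 0ℓ 0ℓ
    cyclic : IsCyclic G
    embedding : Embeds W G

record Theorem1p1Conclusion (g : ℕ) : Setω where
  field
    nonEmbeddable : NonEmbeddableTrade g
    cyclicEmbeddable : CyclicEmbeddableTrade g

module Submission where

-- The three-row frame W = {(r, c, p r c)}, B = {(r, c, p (r+1) c)} built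
-- from three bijections of ℤ/m that are latin in each column and have
-- single-cycle row permutations p (r+1) ∘ (p r)⁻¹ is a separated connected
-- bitrade; with m = 2g + 1 it has 3m cells on 3 + 2m vertices, so genus g.
-- The rows x, x + 1, x + 2 give the cyclic example; replacing x + 1 by
-- τ (x + 1), τ = (0 2)(1 3), breaks the quadrangle criterion (g ≥ 2); for
-- g = 1 an explicit 11-cell trade is checked by evaluation.

open import Level using (0ℓ)
open import Data.Nat using (ℕ; zero; suc; _+_; _*_; _∸_; _≤_; _<_; _≥_; z≤n; s≤s; NonZero; >-nonZero⁻¹; pred)
open import Data.Nat.Properties
  using (+-assoc; +-comm; +-suc; +-identityʳ; m+[n∸m]≡n; m∸n+n≡m; <⇒≤; ≤-trans; *-assoc; suc-pred; m≤n⇒m<n∨m≡n)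
open import Data.Nat.DivMod
  using (_%_; _mod_; %-distribˡ-+; m%n%n≡m%n; [m+n]%n≡m%n; [m+kn]%n≡m%n; m<n⇒m%n≡m; n%n≡0)
open import Data.Nat.Tactic.RingSolver using (solve-∀)
open import Data.Fin using (Fin; suc; toℕ; _≟_)
open import Data.Fin.Patterns using (0F; 1F; 2F; 3F)
open import Data.Fin.Properties using (toℕ-fromℕ<; toℕ-injective; toℕ<n)
import Data.Fin.Properties as FinP
open import Data.Product using (∃-syntax; _×_; _,_; proj₂)
open import Data.Product.Properties using (≡-dec)
open import Data.Sum using (_⊎_; inj₁; inj₂)
open import Data.List using (List; []; _∷_; length; filter; map; cartesianProductWith; allFin)
open import Data.List.Properties using (filter-all; length-++; length-map; length-tabulate)
open import Data.List.Membership.Propositional using (_∈_; find; lose)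
open import Data.List.Membership.Propositional.Properties
  using (∈-cartesianProductWith⁺; ∈-cartesianProductWith⁻; ∈-allFin)
open import Data.List.Relation.Unary.Any using (Any; here; any?; satisfied)
open import Data.List.Relation.Unary.All using (All; all?; lookup)
open import Data.List.Relation.Unary.All.Properties using (tabulate⁺)
open import Data.List.Relation.Unary.AllPairs using (allPairs?)
open import Data.List.Relation.Unary.Unique.Propositional using (Unique)
open import Data.List.Relation.Unary.Unique.Propositional.Properties using (cartesianProductWith⁺; allFin⁺)
open import Function using (id; case_of_)
open import Algebra.Bundles using (Group)
import Algebra.Properties.Group as GroupProperties
open import Relation.Nullary using (¬_; Dec; ¬?; contradiction)
open import Relation.Nullary.Decidable using (_×-dec_; _⊎-dec_; _→-dec_; map′; from-yes)
open import Relation.Unary using (Decidable)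
open import Relation.Binary.Definitions using (DecidableEquality)
open import Relation.Binary.PropositionalEquality
  using (_≡_; _≢_; refl; sym; trans; cong; cong₂; subst; subst₂; isEquivalence; module ≡-Reasoning)
open import Relation.Binary.Construct.Closure.ReflexiveTransitive
  using (Star; ε; _◅_; _◅◅_; gmap; reverse)
open import Defs hiding (sym)

Step : {A : Set} → (A → A) → A → A → Set
Step σ a b = b ≡ σ a

IsCycle : {A : Set} → (A → A) → Set
IsCycle σ = ∀ x y → Star (Step σ) x y

IsCycle-conj : {A : Set} {σ τ : A → A} (φ ρ : A → A) →
               (∀ x → φ (ρ x) ≡ x) → (∀ a → τ (φ a) ≡ φ (σ a)) →
               IsCycle σ → IsCycle τ
IsCycle-conj {τ = τ} φ ρ section commute cyc x y =
  subst₂ (Star (Step τ)) (section x) (section y)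
    (gmap φ (λ {a} b≡σa → trans (cong φ b≡σa) (sym (commute a))) (cyc (ρ x) (ρ y)))

IsCycle-inverse : {A : Set} {σ ρ : A → A} →
                  (∀ a → ρ (σ a) ≡ a) → IsCycle σ → IsCycle ρ
IsCycle-inverse {σ = σ} {ρ = ρ} retract cyc x y = reverse backwards (cyc y x)
  where
  backwards : ∀ {a b} → Step σ a b → Step ρ b a
  backwards {a} b≡σa = trans (sym (retract a)) (cong ρ (sym b≡σa))

module ZMod (m : ℕ) .{{_ : NonZero m}} where
  open ≡-Reasoning

  ⟦_⟧ : ℕ → Fin m
  ⟦ a ⟧ = a mod m

  toℕ-⟦⟧ : ∀ a → toℕ ⟦ a ⟧ ≡ a % m
  toℕ-⟦⟧ a = toℕ-fromℕ< _

  ⟦⟧-cong : ∀ {a b} → a % m ≡ b % m → ⟦ a ⟧ ≡ ⟦ b ⟧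
  ⟦⟧-cong {a} {b} a≡b = toℕ-injective (trans (toℕ-⟦⟧ a) (trans a≡b (sym (toℕ-⟦⟧ b))))

  ⟦toℕ⟧ : ∀ x → ⟦ toℕ x ⟧ ≡ x
  ⟦toℕ⟧ x = toℕ-injective (trans (toℕ-⟦⟧ (toℕ x)) (m<n⇒m%n≡m (toℕ<n x)))

  %-absorbˡ : ∀ a b → (a % m + b) % m ≡ (a + b) % m
  %-absorbˡ a b = begin
    (a % m + b) % m          ≡⟨ %-distribˡ-+ (a % m) b m ⟩
    (a % m % m + b % m) % m  ≡⟨ cong (λ z → (z + b % m) % m) (m%n%n≡m%n a m) ⟩
    (a % m + b % m) % m      ≡⟨ %-distribˡ-+ a b m ⟨
    (a + b) % m              ∎

  %-absorbʳ : ∀ a b → (a + b % m) % m ≡ (a + b) % m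
  %-absorbʳ a b = begin
    (a + b % m) % m  ≡⟨ cong (_% m) (+-comm a (b % m)) ⟩
    (b % m + a) % m  ≡⟨ %-absorbˡ b a ⟩
    (b + a) % m      ≡⟨ cong (_% m) (+-comm b a) ⟩
    (a + b) % m      ∎

  shift : ℕ → Fin m → Fin m
  shift d x = ⟦ toℕ x + d ⟧

  shift-shift : ∀ d e x → shift d (shift e x) ≡ shift (e + d) x
  shift-shift d e x = ⟦⟧-cong (begin
    (toℕ (shift e x) + d) % m  ≡⟨ cong (λ z → (z + d) % m) (toℕ-⟦⟧ _) ⟩
    ((toℕ x + e) % m + d) % m  ≡⟨ %-absorbˡ (toℕ x + e) d ⟩
    (toℕ x + e + d) % m        ≡⟨ cong (_% m) (+-assoc (toℕ x) e d) ⟩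
    (toℕ x + (e + d)) % m      ∎)

  shift-zero : ∀ x → shift 0 x ≡ x
  shift-zero x = trans (cong ⟦_⟧ (+-identityʳ (toℕ x))) (⟦toℕ⟧ x)

  shift-period : ∀ d x → shift (d + m) x ≡ shift d x
  shift-period d x = ⟦⟧-cong (trans (cong (_% m) (sym (+-assoc (toℕ x) d m)))
                                    ([m+n]%n≡m%n (toℕ x + d) m))

  shift-after-pred : ∀ d x → shift (suc d) (shift (m ∸ 1) x) ≡ shift d x
  shift-after-pred d x = begin
    shift (suc d) (shift (pred m) x)  ≡⟨ shift-shift (suc d) (pred m) x ⟩
    shift (pred m + suc d) x          ≡⟨ cong (λ e → shift e x) (+-suc (pred m) d) ⟩
    shift (suc (pred m) + d) x        ≡⟨ cong (λ e → shift (e + d) x) (suc-pred m) ⟩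
    shift (m + d) x                   ≡⟨ cong (λ e → shift e x) (+-comm m d) ⟩
    shift (d + m) x                   ≡⟨ shift-period d x ⟩
    shift d x                         ∎

  toℕ-shift-one : ∀ {x} → toℕ (shift 1 x) ≡ suc (toℕ x) % m
  toℕ-shift-one {x} = trans (toℕ-⟦⟧ (toℕ x + 1)) (cong (_% m) (+-comm (toℕ x) 1))

  shift-one : ∀ x → toℕ (shift 1 x) ≡ suc (toℕ x) ⊎ toℕ (shift 1 x) ≡ 0
  shift-one x with m≤n⇒m<n∨m≡n (toℕ<n x)
  ... | inj₁ x+1<m = inj₁ (trans toℕ-shift-one (m<n⇒m%n≡m x+1<m))
  ... | inj₂ x+1≡m = inj₂ (trans toℕ-shift-one (trans (cong (_% m) x+1≡m) (n%n≡0 m)))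

  shift-cancelˡ : ∀ d x → d ≤ m → shift (m ∸ d) (shift d x) ≡ x
  shift-cancelˡ d x d≤m = begin
    shift (m ∸ d) (shift d x)  ≡⟨ shift-shift (m ∸ d) d x ⟩
    shift (d + (m ∸ d)) x      ≡⟨ cong (λ e → shift e x) (m+[n∸m]≡n d≤m) ⟩
    shift (0 + m) x            ≡⟨ shift-period 0 x ⟩
    shift 0 x                  ≡⟨ shift-zero x ⟩
    x                          ∎

  shift-cancelʳ : ∀ d x → d ≤ m → shift d (shift (m ∸ d) x) ≡ x
  shift-cancelʳ d x d≤m = begin
    shift d (shift (m ∸ d) x)  ≡⟨ shift-shift d (m ∸ d) x ⟩
    shift (m ∸ d + d) x        ≡⟨ cong (λ e → shift e x) (m∸n+n≡m d≤m) ⟩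
    shift (0 + m) x            ≡⟨ shift-period 0 x ⟩
    shift 0 x                  ≡⟨ shift-zero x ⟩
    x                          ∎

  infixl 6 _⊕_
  _⊕_ : Fin m → Fin m → Fin m
  x ⊕ y = shift (toℕ y) x

  𝟘 : Fin m
  𝟘 = ⟦ 0 ⟧

  ⊖_ : Fin m → Fin m
  ⊖ x = ⟦ m ∸ toℕ x ⟧

  toℕ-𝟘 : toℕ 𝟘 ≡ 0
  toℕ-𝟘 = trans (toℕ-⟦⟧ 0) (m<n⇒m%n≡m (>-nonZero⁻¹ m))

  ⊕-assoc : ∀ x y z → (x ⊕ y) ⊕ z ≡ x ⊕ (y ⊕ z)
  ⊕-assoc x y z = ⟦⟧-cong (begin
    (toℕ (x ⊕ y) + toℕ z) % m              ≡⟨ cong (λ a → (a + toℕ z) % m) (toℕ-⟦⟧ _) ⟩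
    ((toℕ x + toℕ y) % m + toℕ z) % m      ≡⟨ %-absorbˡ (toℕ x + toℕ y) (toℕ z) ⟩
    (toℕ x + toℕ y + toℕ z) % m            ≡⟨ cong (_% m) (+-assoc (toℕ x) (toℕ y) (toℕ z)) ⟩
    (toℕ x + (toℕ y + toℕ z)) % m          ≡⟨ %-absorbʳ (toℕ x) (toℕ y + toℕ z) ⟨
    (toℕ x + (toℕ y + toℕ z) % m) % m      ≡⟨ cong (λ a → (toℕ x + a) % m) (toℕ-⟦⟧ _) ⟨
    (toℕ x + toℕ (y ⊕ z)) % m              ∎)

  ⊕-identityˡ : ∀ x → 𝟘 ⊕ x ≡ x
  ⊕-identityˡ x = trans (cong (λ a → ⟦ a + toℕ x ⟧) toℕ-𝟘) (⟦toℕ⟧ x)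

  ⊕-identityʳ : ∀ x → x ⊕ 𝟘 ≡ x
  ⊕-identityʳ x = trans (cong (λ a → shift a x) toℕ-𝟘) (shift-zero x)

  ⊕-comm : ∀ x y → x ⊕ y ≡ y ⊕ x
  ⊕-comm x y = cong ⟦_⟧ (+-comm (toℕ x) (toℕ y))

  ⊕-inverseʳ : ∀ x → x ⊕ ⊖ x ≡ 𝟘
  ⊕-inverseʳ x = ⟦⟧-cong (begin
    (toℕ x + toℕ (⊖ x)) % m        ≡⟨ cong (λ a → (toℕ x + a) % m) (toℕ-⟦⟧ _) ⟩
    (toℕ x + (m ∸ toℕ x) % m) % m  ≡⟨ %-absorbʳ (toℕ x) (m ∸ toℕ x) ⟩
    (toℕ x + (m ∸ toℕ x)) % m      ≡⟨ cong (_% m) (m+[n∸m]≡n (<⇒≤ (toℕ<n x))) ⟩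
    m % m                          ≡⟨ n%n≡0 m ⟩
    0                              ≡⟨ m<n⇒m%n≡m (>-nonZero⁻¹ m) ⟨
    0 % m                          ∎)

  ⊕-inverseˡ : ∀ x → ⊖ x ⊕ x ≡ 𝟘
  ⊕-inverseˡ x = trans (⊕-comm (⊖ x) x) (⊕-inverseʳ x)

  ℤ/m : Group 0ℓ 0ℓ
  ℤ/m = record
    { Carrier = Fin m ; _≈_ = _≡_ ; _∙_ = _⊕_ ; ε = 𝟘 ; _⁻¹ = ⊖_
    ; isGroup = record
      { isMonoid = record
        { isSemigroup = record
          { isMagma = record { isEquivalence = isEquivalence ; ∙-cong = cong₂ _⊕_ }
          ; assoc = ⊕-assoc }
        ; identity = ⊕-identityˡ , ⊕-identityʳ }
      ; inverse = ⊕-inverseˡ , ⊕-inverseʳ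
      ; ⁻¹-cong = cong ⊖_ } }

  pow-one : ∀ j → pow ℤ/m ⟦ 1 ⟧ j ≡ ⟦ j ⟧
  pow-one zero = refl
  pow-one (suc j) = begin
    ⟦ 1 ⟧ ⊕ pow ℤ/m ⟦ 1 ⟧ j  ≡⟨ cong (⟦ 1 ⟧ ⊕_) (pow-one j) ⟩
    ⟦ 1 ⟧ ⊕ ⟦ j ⟧            ≡⟨ ⟦⟧-cong (begin
      (toℕ ⟦ 1 ⟧ + toℕ ⟦ j ⟧) % m  ≡⟨ cong₂ (λ a b → (a + b) % m) (toℕ-⟦⟧ 1) (toℕ-⟦⟧ j) ⟩
      (1 % m + j % m) % m          ≡⟨ %-absorbˡ 1 (j % m) ⟩
      (1 + j % m) % m              ≡⟨ %-absorbʳ 1 j ⟩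
      (1 + j) % m                  ∎) ⟩
    ⟦ suc j ⟧                ∎

  ℤ/m-cyclic : IsCyclic ℤ/m
  ℤ/m-cyclic = ⟦ 1 ⟧ , λ x → toℕ x , inj₁ (trans (sym (⟦toℕ⟧ x)) (sym (pow-one (toℕ x))))

  shift-⊕ : ∀ d x → shift d x ≡ x ⊕ ⟦ d ⟧
  shift-⊕ d x = ⟦⟧-cong (sym (trans (cong (λ a → (toℕ x + a) % m) (toℕ-⟦⟧ d)) (%-absorbʳ (toℕ x) d)))

  ⟦⟧-⊕ : ∀ d x → ⟦ d ⟧ ⊕ x ≡ shift d x
  ⟦⟧-⊕ d x = trans (⊕-comm ⟦ d ⟧ x) (sym (shift-⊕ d x))

  open GroupProperties ℤ/m using (∙-cancelˡ)

  shift-injectiveˡ : ∀ {d e} x → d < m → e < m → shift d x ≡ shift e x → d ≡ e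
  shift-injectiveˡ {d} {e} x d<m e<m eq = begin
    d          ≡⟨ m<n⇒m%n≡m d<m ⟨
    d % m      ≡⟨ toℕ-⟦⟧ d ⟨
    toℕ ⟦ d ⟧  ≡⟨ cong toℕ (∙-cancelˡ x ⟦ d ⟧ ⟦ e ⟧ x⊕d≡x⊕e) ⟩
    toℕ ⟦ e ⟧  ≡⟨ toℕ-⟦⟧ e ⟩
    e % m      ≡⟨ m<n⇒m%n≡m e<m ⟩
    e          ∎
    where
    x⊕d≡x⊕e : x ⊕ ⟦ d ⟧ ≡ x ⊕ ⟦ e ⟧
    x⊕d≡x⊕e = trans (sym (shift-⊕ d x)) (trans eq (shift-⊕ e x))

  shift-no-fixpoint : ∀ d x → suc d < m → shift (suc d) x ≢ x
  shift-no-fixpoint d x d+1<m eq with shift-injectiveˡ x d+1<m (>-nonZero⁻¹ m) (trans eq (sym (shift-zero x)))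
  ... | ()

  iterate-shift : ∀ d n x → Star (Step (shift d)) x (shift (n * d) x)
  iterate-shift d zero x = subst (Star (Step (shift d)) x) (sym (shift-zero x)) ε
  iterate-shift d (suc n) x =
    refl ◅ subst (Star (Step (shift d)) (shift d x)) (shift-shift (n * d) d x) (iterate-shift d n (shift d x))

  private
    distrib : ∀ j k n → j * (1 + k * n) ≡ j + j * k * n
    distrib = solve-∀

  -- Translation by a unit d of ℤ/m (t · d = 1 + k · m) is a single cycle:
  -- from x, (y - x) · t steps of d reach y.
  shift-cycle : ∀ d t k → t * d ≡ 1 + k * m → IsCycle (shift d)
  shift-cycle d t k td≡1 x y =
    subst (Star (Step (shift d)) x) (trans (cong (λ e → shift e x) amount) arrive) (iterate-shift d (j * t) x)
    where
    j = m ∸ toℕ x + toℕ y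
    amount : j * t * d ≡ j + j * k * m
    amount = trans (*-assoc j t d) (trans (cong (j *_) td≡1) (distrib j k m))
    x+j≡y+m : toℕ x + j ≡ toℕ y + m
    x+j≡y+m = begin
      toℕ x + (m ∸ toℕ x + toℕ y)  ≡⟨ +-assoc (toℕ x) (m ∸ toℕ x) (toℕ y) ⟨
      toℕ x + (m ∸ toℕ x) + toℕ y  ≡⟨ cong (_+ toℕ y) (m+[n∸m]≡n (<⇒≤ (toℕ<n x))) ⟩
      m + toℕ y                    ≡⟨ +-comm m (toℕ y) ⟩
      toℕ y + m                    ∎
    arrive : shift (j + j * k * m) x ≡ y
    arrive = trans (⟦⟧-cong (begin
      (toℕ x + (j + j * k * m)) % m  ≡⟨ cong (_% m) (+-assoc (toℕ x) j (j * k * m)) ⟨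
      (toℕ x + j + j * k * m) % m    ≡⟨ [m+kn]%n≡m%n (toℕ x + j) (j * k) m ⟩
      (toℕ x + j) % m                ≡⟨ cong (_% m) x+j≡y+m ⟩
      (toℕ y + m) % m                ≡⟨ [m+n]%n≡m%n (toℕ y) m ⟩
      toℕ y % m                      ∎)) (⟦toℕ⟧ y)

  shift1-cycle : IsCycle (shift 1)
  shift1-cycle = shift-cycle 1 1 0 refl

  -- For odd m = 2g + 1, 2 is a unit with inverse g + 1.
  shift2-cycle : ∀ g → m ≡ suc (g + g) → IsCycle (shift 2)
  shift2-cycle g odd = shift-cycle 2 (suc g) 1 (trans (twice g) (cong (λ n → 1 + 1 * n) (sym odd)))
    where
    twice : ∀ g → suc g * 2 ≡ 1 + 1 * suc (g + g)
    twice = solve-∀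

-- The quadrangle criterion: in a group, x₁y₁ = x₂y₂, x₁y₃ = x₂y₄ and
-- x₃y₁ = x₄y₂ force x₃y₃ = x₄y₄: with d = x₁⁻¹x₂ the first two say
-- y₁ = d y₂ and y₃ = d y₄, and then the third says x₃ d = x₄.
module _ {c ℓ} (G : Group c ℓ) where
  open Group G
  open GroupProperties G using (y≈x\\z; ∙-cancelʳ)
  open import Relation.Binary.Reasoning.Setoid setoid

  divideˡ : ∀ a b x y → a ∙ x ≈ b ∙ y → x ≈ (a \\ b) ∙ y
  divideˡ a b x y ax≈by = begin
    x             ≈⟨ y≈x\\z a x (b ∙ y) ax≈by ⟩
    a \\ (b ∙ y)  ≈⟨ assoc (a ⁻¹) b y ⟨
    (a \\ b) ∙ y  ∎

  quadrangle : ∀ {x₁ x₂ x₃ x₄ y₁ y₂ y₃ y₄} →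
               x₁ ∙ y₁ ≈ x₂ ∙ y₂ → x₁ ∙ y₃ ≈ x₂ ∙ y₄ → x₃ ∙ y₁ ≈ x₄ ∙ y₂ →
               x₃ ∙ y₃ ≈ x₄ ∙ y₄
  quadrangle {x₁} {x₂} {x₃} {x₄} {y₁} {y₂} {y₃} {y₄} e₁ e₂ e₃ = begin
    x₃ ∙ y₃        ≈⟨ ∙-congˡ (divideˡ x₁ x₂ y₃ y₄ e₂) ⟩
    x₃ ∙ (d ∙ y₄)  ≈⟨ assoc x₃ d y₄ ⟨
    (x₃ ∙ d) ∙ y₄  ≈⟨ ∙-congʳ x₃d≈x₄ ⟩
    x₄ ∙ y₄        ∎
    where
    d = x₁ \\ x₂
    x₃d≈x₄ : x₃ ∙ d ≈ x₄
    x₃d≈x₄ = ∙-cancelʳ y₂ (x₃ ∙ d) x₄ (begin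
      (x₃ ∙ d) ∙ y₂  ≈⟨ assoc x₃ d y₂ ⟩
      x₃ ∙ (d ∙ y₂)  ≈⟨ ∙-congˡ (divideˡ x₁ x₂ y₁ y₂ e₁) ⟨
      x₃ ∙ y₁        ≈⟨ e₃ ⟩
      x₄ ∙ y₂        ∎)

-- Eight cells of a partial latin square violating the quadrangle
-- criterion: the first six give the three hypotheses above, the last two
-- would then have to carry the same symbol, but they do not.
record QuadrangleViolation {n m k : ℕ} (P : List (Triple {n} {m} {k})) : Set where
  field
    {r₁ r₂ r₃ r₄} : Fin n
    {c₁ c₂ c₃ c₄} : Fin m
    {s₁ s₂ s₃ s₄ s₅} : Fin k
    cell₁₁ : (r₁ , c₁ , s₁) ∈ P
    cell₂₂ : (r₂ , c₂ , s₁) ∈ P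
    cell₁₃ : (r₁ , c₃ , s₂) ∈ P
    cell₂₄ : (r₂ , c₄ , s₂) ∈ P
    cell₃₁ : (r₃ , c₁ , s₃) ∈ P
    cell₄₂ : (r₄ , c₂ , s₃) ∈ P
    cell₃₃ : (r₃ , c₃ , s₄) ∈ P
    cell₄₄ : (r₄ , c₄ , s₅) ∈ P
    s₄≢s₅ : s₄ ≢ s₅

violation⇒¬embeds : ∀ {n m k} {P : List (Triple {n} {m} {k})} → QuadrangleViolation P →
                    ∀ {c ℓ} (G : Group c ℓ) → ¬ Embeds P G
violation⇒¬embeds V G (f , h , κ , _ , _ , κ-injective , cell) =
  s₄≢s₅ (κ-injective _ _ (_ , _ , cell₃₃) (_ , _ , cell₄₄) κs₄≈κs₅)
  where
  open QuadrangleViolation V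
  open Group G using () renaming (sym to ≈-sym; trans to ≈-trans)
  κs₄≈κs₅ = ≈-trans (≈-sym (cell cell₃₃))
              (≈-trans (quadrangle G (≈-trans (cell cell₁₁) (≈-sym (cell cell₂₂)))
                                     (≈-trans (cell cell₁₃) (≈-sym (cell cell₂₄)))
                                     (≈-trans (cell cell₃₁) (≈-sym (cell cell₄₂))))
                       (cell cell₄₄))

module _ {n m k : ℕ} where
  private
    T : Set
    T = Triple {n} {m} {k}

  OneDiff : T → T → Set
  OneDiff (r , c , s) (r' , c' , s') =
    (r' ≢ r × c' ≡ c × s' ≡ s) ⊎ (r' ≡ r × c' ≢ c × s' ≡ s) ⊎ (r' ≡ r × c' ≡ c × s' ≢ s)

  OneDiff-sym : ∀ {t u} → OneDiff t u → OneDiff u t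
  OneDiff-sym (inj₁ (r'≢r , refl , refl)) = inj₁ ((λ e → r'≢r (sym e)) , refl , refl)
  OneDiff-sym (inj₂ (inj₁ (refl , c'≢c , refl))) = inj₂ (inj₁ (refl , (λ e → c'≢c (sym e)) , refl))
  OneDiff-sym (inj₂ (inj₂ (refl , refl , s'≢s))) = inj₂ (inj₂ (refl , refl , (λ e → s'≢s (sym e))))

  -- Mates are unique, so a sub-trade X' ⊆ X with mate Y' ⊆ Y (where Y
  -- is the mate of X) must contain in Y' every cell of Y one coordinate
  -- away from a cell of X'.
  mate-closed : {X Y X' Y' : List T} → Mates X Y → Mates X' Y' →
                (∀ {t} → t ∈ X' → t ∈ X) → (∀ {t} → t ∈ Y' → t ∈ Y) →
                ∀ {t u} → t ∈ X' → u ∈ Y → OneDiff t u → u ∈ Y'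
  mate-closed {Y' = Y'} mXY mX'Y' X'⊆X Y'⊆Y {r , c , s} t∈ u∈ (inj₁ (r'≢r , refl , refl))
    with mX'Y' t∈ | mXY (X'⊆X t∈)
  ... | (r* , r*≢r , mate∈ , _) , _ | (_ , _ , _ , unique) , _ =
    subst (λ z → (z , c , s) ∈ Y') (trans (unique r* r*≢r (Y'⊆Y mate∈)) (sym (unique _ r'≢r u∈))) mate∈
  mate-closed {Y' = Y'} mXY mX'Y' X'⊆X Y'⊆Y {r , c , s} t∈ u∈ (inj₂ (inj₁ (refl , c'≢c , refl)))
    with mX'Y' t∈ | mXY (X'⊆X t∈)
  ... | _ , (c* , c*≢c , mate∈ , _) , _ | _ , (_ , _ , _ , unique) , _ =
    subst (λ z → (r , z , s) ∈ Y') (trans (unique c* c*≢c (Y'⊆Y mate∈)) (sym (unique _ c'≢c u∈))) mate∈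
  mate-closed {Y' = Y'} mXY mX'Y' X'⊆X Y'⊆Y {r , c , s} t∈ u∈ (inj₂ (inj₂ (refl , refl , s'≢s)))
    with mX'Y' t∈ | mXY (X'⊆X t∈)
  ... | _ , _ , (s* , s*≢s , mate∈ , _) | _ , _ , (_ , _ , _ , unique) =
    subst (λ z → (r , c , z) ∈ Y') (trans (unique s* s*≢s (Y'⊆Y mate∈)) (sym (unique _ s'≢s u∈))) mate∈

  Linked : List T → List T → T → T → Set
  Linked W B t t' = t ∈ W × t' ∈ W × ∃[ u ] (u ∈ B × OneDiff t u × OneDiff u t')

  Linked-sym : ∀ {W B t t'} → Linked W B t t' → Linked W B t' t
  Linked-sym (t∈ , t'∈ , u , u∈ , t~u , u~t') = t'∈ , t∈ , u , u∈ , OneDiff-sym u~t' , OneDiff-sym t~u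

  -- Connectedness criterion: if all of W is reachable from one cell along
  -- links, then any sub-bitrade containing a cell of W contains all of W,
  -- so W cannot split into two disjoint bitrades.
  connected-from-hub : {W B : List T} → Mates W B → Mates B W →
                       (t₀ : T) → (∀ {t} → t ∈ W → Star (Linked W B) t₀ t) → Connected W B
  connected-from-hub {W} {B} mWB mBW t₀ path
    (W' , B' , W'' , B'' , ((t' , t'∈W') , _ , _ , _ , mW'B' , mB'W') , ((t'' , t''∈W'') , _) ,
     disjoint , W=W'∪W'' , B=B'∪B'') =
    disjoint (spread (reverse Linked-sym (path (W'⊆W t'∈W')) ◅◅ path (W''⊆W t''∈W'')) t'∈W') t''∈W''
    where
    W'⊆W : ∀ {t} → t ∈ W' → t ∈ W
    W'⊆W {t} t∈ = proj₂ (W=W'∪W'' t) (inj₁ t∈)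
    W''⊆W : ∀ {t} → t ∈ W'' → t ∈ W
    W''⊆W {t} t∈ = proj₂ (W=W'∪W'' t) (inj₂ t∈)
    B'⊆B : ∀ {t} → t ∈ B' → t ∈ B
    B'⊆B {t} t∈ = proj₂ (B=B'∪B'' t) (inj₁ t∈)
    spread : ∀ {t t'} → Star (Linked W B) t t' → t ∈ W' → t' ∈ W'
    spread ε t∈ = t∈
    spread ((_ , t'∈ , u , u∈ , t~u , u~t') ◅ links) t∈ =
      spread links (mate-closed mBW mB'W' B'⊆B W'⊆W (mate-closed mWB mW'B' W'⊆W B'⊆B t∈ u∈ t~u) t'∈ u~t')

nxt : Fin 3 → Fin 3
nxt 0F = suc 0F
nxt 1F = suc 1F
nxt 2F = 0F

prv : Fin 3 → Fin 3
prv 0F = suc 1F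
prv 1F = 0F
prv 2F = suc 0F

nxt-prv : ∀ r → nxt (prv r) ≡ r
nxt-prv 0F = refl
nxt-prv 1F = refl
nxt-prv 2F = refl

prv-nxt : ∀ r → prv (nxt r) ≡ r
prv-nxt 0F = refl
prv-nxt 1F = refl
prv-nxt 2F = refl

nxt≢ : ∀ r → nxt r ≢ r
nxt≢ 0F ()
nxt≢ 1F ()
nxt≢ 2F ()

prv≢ : ∀ r → prv r ≢ r
prv≢ 0F ()
prv≢ 1F ()
prv≢ 2F ()

nxt-cycle : IsCycle nxt
nxt-cycle 0F 0F = ε
nxt-cycle 0F 1F = refl ◅ ε
nxt-cycle 0F 2F = refl ◅ refl ◅ ε
nxt-cycle 1F 0F = refl ◅ refl ◅ ε
nxt-cycle 1F 1F = ε
nxt-cycle 1F 2F = refl ◅ ε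
nxt-cycle 2F 0F = refl ◅ ε
nxt-cycle 2F 1F = refl ◅ refl ◅ ε
nxt-cycle 2F 2F = ε

prv-cycle : IsCycle prv
prv-cycle = IsCycle-inverse prv-nxt nxt-cycle

length-cartesianProductWith : ∀ {A B C : Set} (f : A → B → C) xs ys →
                              length (cartesianProductWith f xs ys) ≡ length xs * length ys
length-cartesianProductWith f [] ys = refl
length-cartesianProductWith f (x ∷ xs) ys =
  trans (length-++ (map (f x) ys))
        (cong₂ _+_ (length-map (f x) ys) (length-cartesianProductWith f xs ys))

length-filter-allFin : ∀ {n} {P : Fin n → Set} (P? : Decidable P) →
                       (∀ i → P i) → length (filter P? (allFin n)) ≡ n
length-filter-allFin P? everywhere =
  trans (cong length (filter-all P? (tabulate⁺ everywhere))) (length-tabulate id)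

-- If each column of W has three distinct symbols and
-- each "row permutation" p (nxt r) ∘ q r is a single m-cycle, then (W, B)
-- is a separated connected bitrade, of genus g when m = 2g + 1.
module ThreeRowFrame (m : ℕ) (x₀ : Fin m) (p q : Fin 3 → Fin m → Fin m)
  (p∘q : ∀ r x → p r (q r x) ≡ x) (q∘p : ∀ r x → q r (p r x) ≡ x)
  (column-latin : ∀ r r' c → p r c ≡ p r' c → r ≡ r')
  (row-cycle : ∀ r → IsCycle (λ a → p (nxt r) (q r a))) where

  T : Set
  T = Triple {3} {m} {m}

  cellW cellB : Fin 3 → Fin m → T
  cellW r c = (r , c , p r c)
  cellB r c = (r , c , p (nxt r) c)

  W B : List T
  W = cartesianProductWith cellW (allFin 3) (allFin m)
  B = cartesianProductWith cellB (allFin 3) (allFin m)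

  inW : ∀ r c → cellW r c ∈ W
  inW r c = ∈-cartesianProductWith⁺ cellW (∈-allFin r) (∈-allFin c)

  inB : ∀ r c → cellB r c ∈ B
  inB r c = ∈-cartesianProductWith⁺ cellB (∈-allFin r) (∈-allFin c)

  inW' : ∀ {r c s} → s ≡ p r c → (r , c , s) ∈ W
  inW' {r} {c} refl = inW r c

  inB' : ∀ {r c s} → s ≡ p (nxt r) c → (r , c , s) ∈ B
  inB' {r} {c} refl = inB r c

  memW : ∀ {r c s} → (r , c , s) ∈ W → s ≡ p r c
  memW t∈ with ∈-cartesianProductWith⁻ cellW (allFin 3) (allFin m) t∈
  ... | _ , _ , _ , _ , refl = refl

  memB : ∀ {r c s} → (r , c , s) ∈ B → s ≡ p (nxt r) c
  memB t∈ with ∈-cartesianProductWith⁻ cellB (allFin 3) (allFin m) t∈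
  ... | _ , _ , _ , _ , refl = refl

  p-injective : ∀ r {x y} → p r x ≡ p r y → x ≡ y
  p-injective r {x} {y} e = trans (sym (q∘p r x)) (trans (cong (q r) e) (q∘p r y))

  nxt-differs : ∀ r c → p (nxt r) c ≢ p r c
  nxt-differs r c e = nxt≢ r (column-latin (nxt r) r c e)

  triple-≡ : ∀ {r r' : Fin 3} {c c' s s' : Fin m} → r ≡ r' → c ≡ c' → s ≡ s' →
             _≡_ {A = T} (r , c , s) (r' , c' , s')
  triple-≡ refl refl refl = refl

  module Latin (f : Fin 3 → Fin m → Fin m)
    (row-injective : ∀ r {x y} → f r x ≡ f r y → x ≡ y)
    (column-injective : ∀ r r' c → f r c ≡ f r' c → r ≡ r') where

    agree : ∀ {r r' c c' s s'} → s ≡ f r c → s' ≡ f r' c' →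
            (r ≡ r' × c ≡ c') ⊎ (r ≡ r' × s ≡ s') ⊎ (c ≡ c' × s ≡ s') →
            _≡_ {A = T} (r , c , s) (r' , c' , s')
    agree e e' (inj₁ (refl , refl)) = triple-≡ refl refl (trans e (sym e'))
    agree {r} e e' (inj₂ (inj₁ (refl , refl))) = triple-≡ refl (row-injective r (trans (sym e) e')) refl
    agree {r} {r'} {c} e e' (inj₂ (inj₂ (refl , refl))) =
      triple-≡ (column-injective r r' c (trans (sym e) e')) refl refl

  plsW : IsPLS W
  plsW = cartesianProductWith⁺ cellW (λ { refl → refl , refl }) (allFin⁺ 3) (allFin⁺ m) ,
         λ t u → Latin.agree p p-injective column-latin (memW t) (memW u)

  plsB : IsPLS B
  plsB = cartesianProductWith⁺ cellB (λ { refl → refl , refl }) (allFin⁺ 3) (allFin⁺ m) ,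
         λ t u → Latin.agree (λ r → p (nxt r)) (λ r → p-injective (nxt r)) nxt-injective (memB t) (memB u)
    where
    nxt-injective : ∀ r r' c → p (nxt r) c ≡ p (nxt r') c → r ≡ r'
    nxt-injective r r' c e = trans (sym (prv-nxt r)) (trans (cong prv (column-latin (nxt r) (nxt r') c e)) (prv-nxt r'))

  -- The mates of a W-cell (r, c, p r c): the B-cells of the previous row in
  -- the same column and symbol, of the same row and symbol, and of the same
  -- row and column.
  matesWB : Mates W B
  matesWB {r} {c} t∈ with memW t∈
  ... | refl =
    (prv r , prv≢ r , inB' (cong (λ z → p z c) (sym (nxt-prv r))) ,
       λ r'' _ u∈ → trans (sym (prv-nxt r'')) (cong prv (column-latin (nxt r'') r c (sym (memB u∈))))) ,
    (q (nxt r) (p r c) , (λ e → nxt-differs r c (trans (cong (p (nxt r)) (sym e)) (p∘q (nxt r) (p r c)))) ,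
       inB' (sym (p∘q (nxt r) (p r c))) ,
       λ c'' _ u∈ → trans (sym (q∘p (nxt r) c'')) (cong (q (nxt r)) (sym (memB u∈)))) ,
    (p (nxt r) c , nxt-differs r c , inB r c , λ _ _ u∈ → memB u∈)

  matesBW : Mates B W
  matesBW {r} {c} t∈ with memB t∈
  ... | refl =
    (nxt r , nxt≢ r , inW (nxt r) c , λ r'' _ u∈ → column-latin r'' (nxt r) c (sym (memW u∈))) ,
    (q r (p (nxt r) c) , (λ e → nxt-differs r c (trans (sym (p∘q r (p (nxt r) c))) (cong (p r) e))) ,
       inW' (sym (p∘q r (p (nxt r) c))) ,
       λ c'' _ u∈ → trans (sym (q∘p r c'')) (cong (q r) (sym (memW u∈)))) ,
    (p r c , (λ e → nxt-differs r c (sym e)) , inW r c , λ _ _ u∈ → memW u∈)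

  bitrade : IsBitrade W B
  bitrade = (_ , inW 0F x₀) , (_ , inB 0F x₀) , plsW , plsB , matesWB , matesBW

  -- The row permutation of row r is σ r; a column permutation is nxt on
  -- the rows (transported to symbols); a symbol permutation is prv.
  σ : Fin 3 → Fin m → Fin m
  σ r a = p (nxt r) (q r a)

  cellS : Fin 3 → Fin m → T
  cellS r a = (r , q r a , a)

  inW-cellS : ∀ r a → cellS r a ∈ W
  inW-cellS r a = inW' (sym (p∘q r a))

  separated : Separated W B
  separated = row-sep , column-sep , symbol-sep
    where
    row-sep : ∀ r → SingleCycle {3} {m} {m} (λ s → ∃[ c ] ((r , c , s) ∈ W)) (ψrow W B r)
    row-sep r x y _ _ = gmap id (λ {a} b≡σa → q r a , inW-cellS r a , inB' b≡σa) (row-cycle r x y)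

    column-sep : ∀ c → SingleCycle {3} {m} {m} (λ s → ∃[ r ] ((r , c , s) ∈ W)) (ψcol W B c)
    column-sep c x y (r₁ , x∈) (r₂ , y∈) with memW x∈ | memW y∈
    ... | refl | refl = gmap (λ r → p r c) (λ {a} → λ { refl → a , inW a c , inB a c }) (nxt-cycle r₁ r₂)

    symbol-sep : ∀ s → SingleCycle {3} {m} {m} (λ r → ∃[ c ] ((r , c , s) ∈ W)) (ψsym W B s)
    symbol-sep s x y _ _ =
      gmap id (λ {a} → λ { refl → q a s , inW-cellS a s , inB' (previous-row a) }) (prv-cycle x y)
      where
      previous-row : ∀ a → s ≡ p (nxt (prv a)) (q a s)
      previous-row a = trans (sym (p∘q a s)) (cong (λ z → p z (q a s)) (sym (nxt-prv a)))

  -- Links inside a row (change symbol a ↦ σ r a, then column) and down a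
  -- column (change symbol, then row r ↦ nxt r).
  symbol-link : ∀ r a → Linked W B (cellS r a) (cellS r (σ r a))
  symbol-link r a =
    inW-cellS r a , inW-cellS r (σ r a) , cellB r (q r a) , inB r (q r a) ,
    inj₂ (inj₂ (refl , refl , σ-moves)) , inj₂ (inj₁ (refl , (λ e → σ-moves (q-injective e)) , refl))
    where
    σ-moves : σ r a ≢ a
    σ-moves e = nxt-differs r (q r a) (trans e (sym (p∘q r a)))
    q-injective : q r (σ r a) ≡ q r a → σ r a ≡ a
    q-injective e = trans (sym (p∘q r (σ r a))) (trans (cong (p r) e) (p∘q r a))

  row-link : ∀ r c → Linked W B (cellW r c) (cellW (nxt r) c)
  row-link r c =
    inW r c , inW (nxt r) c , cellB r c , inB r c ,
    inj₂ (inj₂ (refl , refl , nxt-differs r c)) , inj₁ (nxt≢ r , refl , refl)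

  along-row : ∀ r a b → Star (Linked W B) (cellS r a) (cellS r b)
  along-row r a b = gmap (cellS r) (λ { refl → symbol-link r _ }) (row-cycle r a b)

  down-column : ∀ c r r' → Star (Linked W B) (cellW r c) (cellW r' c)
  down-column c r r' = gmap (λ r → cellW r c) (λ { refl → row-link _ c }) (nxt-cycle r r')

  -- Every W-cell is reached from cellS 0 x₀: along row 0 to the right
  -- column, then down that column.
  path : ∀ {t} → t ∈ W → Star (Linked W B) (cellS 0F x₀) t
  path {r , c , _} t∈ with memW t∈
  ... | refl = subst (Star (Linked W B) (cellS 0F x₀)) (cong (λ z → (0F , z , p 0F c)) (q∘p 0F c))
                 (along-row 0F x₀ (p 0F c))
               ◅◅ down-column c 0F r

  connected : Connected W B
  connected = connected-from-hub matesWB matesBW (cellS 0F x₀) path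

  -- Genus: W has 3m cells and uses 3 rows, m columns and m symbols.
  genus : ∀ g → m ≡ suc (g + g) → GenusEq W g
  genus g odd = begin
    2 * g + length (usedRows W) + length (usedCols W) + length (usedSyms W)
      ≡⟨ cong (λ a → 2 * g + a + length (usedCols W) + length (usedSyms W)) used-rows ⟩
    2 * g + 3 + length (usedCols W) + length (usedSyms W)
      ≡⟨ cong₂ (λ a b → 2 * g + 3 + a + b) used-columns used-symbols ⟩
    2 * g + 3 + m + m
      ≡⟨ cong (λ n → 2 * g + 3 + n + n) odd ⟩
    2 * g + 3 + suc (g + g) + suc (g + g)
      ≡⟨ count g ⟩
    2 + 3 * suc (g + g)
      ≡⟨ cong (λ n → 2 + 3 * n) odd ⟨
    2 + 3 * m
      ≡⟨ cong (2 +_) size ⟨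
    2 + length W ∎
    where
    open ≡-Reasoning
    count : ∀ g → 2 * g + 3 + suc (g + g) + suc (g + g) ≡ 2 + 3 * suc (g + g)
    count = solve-∀
    size : length W ≡ 3 * m
    size = trans (length-cartesianProductWith cellW (allFin 3) (allFin m)) (cong (3 *_) (length-tabulate {n = m} id))
    used-rows : length (usedRows W) ≡ 3
    used-rows = length-filter-allFin (λ r → any? (λ t → r ≟ row t) W) (λ r → lose (inW r x₀) refl)
    used-columns : length (usedCols W) ≡ m
    used-columns = length-filter-allFin (λ c → any? (λ t → c ≟ col t) W) (λ c → lose (inW 0F c) refl)
    used-symbols : length (usedSyms W) ≡ m
    used-symbols = length-filter-allFin (λ s → any? (λ t → s ≟ Defs.sym t) W) (λ s → lose (inW-cellS 0F s) refl)

  hasGenus : ∀ g → m ≡ suc (g + g) → HasGenus W g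
  hasGenus g odd = B , bitrade , separated , connected , genus g odd

-- Frames whose outer rows are x ↦ x and x ↦ x + 2 in ℤ/m (m = 2g + 1):
-- the middle row π only has to avoid both neighbours columnwise and make
-- π and (x ↦ π⁻¹ x + 2) single cycles; the third row permutation
-- x ↦ x - 2 is a single cycle because m is odd.
module MiddleRow (m : ℕ) .{{_ : NonZero m}} (g : ℕ) (odd : m ≡ suc (g + g)) (2<m : 2 < m)
  (π π⁻ : Fin m → Fin m) (π∘π⁻ : ∀ x → π (π⁻ x) ≡ x) (π⁻∘π : ∀ x → π⁻ (π x) ≡ x)
  (π-moves : ∀ c → π c ≢ c) (π-avoids-shift2 : ∀ c → π c ≢ ZMod.shift m 2 c)
  (π-cycle : IsCycle π) (π⁻-cycle : IsCycle (λ a → ZMod.shift m 2 (π⁻ a))) where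

  open ZMod m

  p q : Fin 3 → Fin m → Fin m
  p 0F = id
  p 1F = π
  p 2F = shift 2
  q 0F = id
  q 1F = π⁻
  q 2F = shift (m ∸ 2)

  p∘q : ∀ r x → p r (q r x) ≡ x
  p∘q 0F x = refl
  p∘q 1F x = π∘π⁻ x
  p∘q 2F x = shift-cancelʳ 2 x (<⇒≤ 2<m)

  q∘p : ∀ r x → q r (p r x) ≡ x
  q∘p 0F x = refl
  q∘p 1F x = π⁻∘π x
  q∘p 2F x = shift-cancelˡ 2 x (<⇒≤ 2<m)

  two-moves : ∀ c → shift 2 c ≢ c
  two-moves c = shift-no-fixpoint 1 c 2<m

  column-latin : ∀ r r' c → p r c ≡ p r' c → r ≡ r'
  column-latin 0F 0F c e = refl
  column-latin 0F 1F c e = contradiction (sym e) (π-moves c)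
  column-latin 0F 2F c e = contradiction (sym e) (two-moves c)
  column-latin 1F 0F c e = contradiction e (π-moves c)
  column-latin 1F 1F c e = refl
  column-latin 1F 2F c e = contradiction e (π-avoids-shift2 c)
  column-latin 2F 0F c e = contradiction e (two-moves c)
  column-latin 2F 1F c e = contradiction (sym e) (π-avoids-shift2 c)
  column-latin 2F 2F c e = refl

  row-cycle : ∀ r → IsCycle (λ a → p (nxt r) (q r a))
  row-cycle 0F = π-cycle
  row-cycle 1F = π⁻-cycle
  row-cycle 2F = IsCycle-inverse (λ a → shift-cancelˡ 2 a (<⇒≤ 2<m)) (shift2-cycle g odd)

  open ThreeRowFrame m 𝟘 p q p∘q q∘p column-latin row-cycle public

-- The trade with rows x ↦ x, x + 1, x + 2 of ℤ/m, m = 2g + 1, g = h + 1;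
-- it embeds in ℤ/m via row r ↦ r, column c ↦ c, symbol s ↦ s.
module CyclicTrade (h : ℕ) where
  m g : ℕ
  m = suc (suc (suc (h + h)))
  g = suc h

  odd : m ≡ suc (g + g)
  odd = cong (λ n → suc (suc n)) (sym (+-suc h h))

  open ZMod m

  1<m : 1 < m
  1<m = s≤s (s≤s z≤n)

  2<m : 2 < m
  2<m = s≤s (s≤s (s≤s z≤n))

  open MiddleRow m g odd 2<m (shift 1) (shift (m ∸ 1))
    (λ x → shift-cancelʳ 1 x (<⇒≤ 1<m)) (λ x → shift-cancelˡ 1 x (<⇒≤ 1<m))
    (λ c → shift-no-fixpoint 0 c 1<m) (λ c e → case (shift-injectiveˡ c 1<m 2<m e) of λ ())
    shift1-cycle (IsCycle-conj id id (λ _ → refl) (shift-after-pred 1) shift1-cycle) public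

  embeds : Embeds W ℤ/m
  embeds = (λ r → ⟦ toℕ r ⟧) , id , id , row-injective , (λ _ _ _ _ → id) , (λ _ _ _ _ → id) , cell-sum
    where
    toℕ-row : ∀ (r : Fin 3) → toℕ ⟦ toℕ r ⟧ ≡ toℕ r
    toℕ-row r = trans (toℕ-⟦⟧ (toℕ r)) (m<n⇒m%n≡m (≤-trans (toℕ<n r) 2<m))
    row-injective : ∀ r r' → _ → _ → ⟦ toℕ r ⟧ ≡ ⟦ toℕ r' ⟧ → r ≡ r'
    row-injective r r' _ _ e = toℕ-injective (trans (sym (toℕ-row r)) (trans (cong toℕ e) (toℕ-row r')))
    row-sum : ∀ r c → ⟦ toℕ r ⟧ ⊕ c ≡ p r c
    row-sum 0F c = ⊕-identityˡ c
    row-sum 1F c = ⟦⟧-⊕ 1 c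
    row-sum 2F c = ⟦⟧-⊕ 2 c
    cell-sum : ∀ {r c s} → (r , c , s) ∈ W → ⟦ toℕ r ⟧ ⊕ c ≡ s
    cell-sum {r} {c} t∈ = trans (row-sum r c) (sym (memW t∈))

-- The twisted trade: the middle row x ↦ x + 1 is replaced by
-- x ↦ τ (x + 1), τ = (0 2)(1 3), with m = 2g + 1, g = h + 2 ≥ 2.  Its
-- first two row permutations are relabellings of x ↦ x + 1, but it
-- violates the quadrangle criterion, so it embeds in no group.
module TwistedTrade (h : ℕ) where
  m g : ℕ
  m = suc (suc (suc (suc (suc (h + h)))))
  g = suc (suc h)

  odd : m ≡ suc (g + g)
  odd = cong (λ n → suc (suc (suc n))) (sym (trans (+-suc h (suc h)) (cong suc (+-suc h h))))

  open ZMod m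

  1<m : 1 < m
  1<m = s≤s (s≤s z≤n)

  2<m : 2 < m
  2<m = s≤s (s≤s (s≤s z≤n))

  τ : Fin m → Fin m
  τ 0F = 2F
  τ 1F = 3F
  τ 2F = 0F
  τ 3F = 1F
  τ x = x

  τ-involutive : ∀ x → τ (τ x) ≡ x
  τ-involutive 0F = refl
  τ-involutive 1F = refl
  τ-involutive 2F = refl
  τ-involutive 3F = refl
  τ-involutive (suc (suc (suc (suc x)))) = refl

  τ-not-forward : ∀ x → τ x ≢ shift 1 x
  τ-not-forward 0F ()
  τ-not-forward 1F ()
  τ-not-forward 2F ()
  τ-not-forward 3F ()
  τ-not-forward x@(suc (suc (suc (suc _)))) e = shift-no-fixpoint 0 x 1<m (sym e)

  τ-not-backward : ∀ x → shift 1 (τ x) ≢ x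
  τ-not-backward 0F ()
  τ-not-backward 1F ()
  τ-not-backward 2F ()
  τ-not-backward 3F ()
  τ-not-backward x@(suc (suc (suc (suc _)))) = shift-no-fixpoint 0 x 1<m

  -- ρ = x ↦ τ x + 1 runs 0, 3, 2, 1, 4, 5, …, m - 1: it is the cycle
  -- x ↦ x + 1 relabelled by the transposition (1 3).
  ρ : Fin m → Fin m
  ρ x = shift 1 (τ x)

  swap₁₃ : Fin m → Fin m
  swap₁₃ 1F = 3F
  swap₁₃ 3F = 1F
  swap₁₃ x = x

  swap₁₃-involutive : ∀ x → swap₁₃ (swap₁₃ x) ≡ x
  swap₁₃-involutive 0F = refl
  swap₁₃-involutive 1F = refl
  swap₁₃-involutive 2F = refl
  swap₁₃-involutive 3F = refl
  swap₁₃-involutive (suc (suc (suc (suc x)))) = refl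

  -- (1 3) fixes 0 and every point ≥ 5, hence every point one step after a
  -- point ≥ 4 (see shift-one).
  swap₁₃-fixes : ∀ x {n} → toℕ x ≡ 5 + n ⊎ toℕ x ≡ 0 → swap₁₃ x ≡ x
  swap₁₃-fixes 0F _ = refl
  swap₁₃-fixes 1F (inj₁ ())
  swap₁₃-fixes 1F (inj₂ ())
  swap₁₃-fixes 2F _ = refl
  swap₁₃-fixes 3F (inj₁ ())
  swap₁₃-fixes 3F (inj₂ ())
  swap₁₃-fixes (suc (suc (suc (suc _)))) _ = refl

  ρ-relabels : ∀ a → ρ (swap₁₃ a) ≡ swap₁₃ (shift 1 a)
  ρ-relabels 0F = refl
  ρ-relabels 1F = refl
  ρ-relabels 2F = refl
  ρ-relabels 3F = refl
  ρ-relabels a@(suc (suc (suc (suc _)))) = sym (swap₁₃-fixes (shift 1 a) (shift-one a))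

  ρ-cycle : IsCycle ρ
  ρ-cycle = IsCycle-conj swap₁₃ swap₁₃ swap₁₃-involutive ρ-relabels shift1-cycle

  π π⁻ : Fin m → Fin m
  π x = τ (shift 1 x)
  π⁻ x = shift (m ∸ 1) (τ x)

  open MiddleRow m g odd 2<m π π⁻
    (λ x → trans (cong τ (shift-cancelʳ 1 (τ x) (<⇒≤ 1<m))) (τ-involutive x))
    (λ x → trans (cong (shift (m ∸ 1)) (τ-involutive (shift 1 x))) (shift-cancelˡ 1 x (<⇒≤ 1<m)))
    (λ c e → τ-not-backward (shift 1 c) (cong (shift 1) e))
    (λ c e → τ-not-forward (shift 1 c) (trans e (sym (shift-shift 1 1 c))))
    (IsCycle-conj τ τ τ-involutive (λ _ → refl) ρ-cycle)
    (IsCycle-conj id id (λ _ → refl) (λ a → shift-after-pred 1 (τ a)) ρ-cycle) public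

  -- Rows 1, 0 agree in symbol 0 at columns 1, 0 and in symbol 3 at columns
  -- 0, 3; rows 2, 1 agree in symbol 3 at columns 1, 0; but cells (2, 0) and
  -- (1, 3) carry the different symbols 2 and 4.
  violation : QuadrangleViolation W
  violation = record
    { cell₁₁ = inW 1F 1F ; cell₂₂ = inW 0F 0F
    ; cell₁₃ = inW 1F 0F ; cell₂₄ = inW 0F 3F
    ; cell₃₁ = inW 2F 1F ; cell₄₂ = inW 1F 0F
    ; cell₃₃ = inW 2F 0F ; cell₄₄ = inW 1F 3F
    ; s₄≢s₅ = λ () }

-- Paths of length at most d whose intermediate points come from a list;
-- decidable when the step relation is, so a finite connectivity claim can
-- be checked by evaluation.
module BoundedPaths {A : Set} (_≟A_ : DecidableEquality A) (points : List A)
                    (R : A → A → Set) (R? : ∀ x y → Dec (R x y)) where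

  Within : ℕ → A → A → Set
  Within zero x y = x ≡ y
  Within (suc d) x y = x ≡ y ⊎ Any (λ z → R x z × Within d z y) points

  within? : ∀ d x y → Dec (Within d x y)
  within? zero x y = x ≟A y
  within? (suc d) x y = (x ≟A y) ⊎-dec any? (λ z → R? x z ×-dec within? d z y) points

  within⇒star : ∀ d {x y} → Within d x y → Star R x y
  within⇒star zero refl = ε
  within⇒star (suc d) (inj₁ refl) = ε
  within⇒star (suc d) (inj₂ step) with satisfied step
  ... | _ , x→z , z→y = x→z ◅ within⇒star d z→y

module SingleCycleCheck {N : ℕ} (D : Fin N → Set) (D? : Decidable D)
                        (ψ : Fin N → Fin N → Set) (ψ? : ∀ x y → Dec (ψ x y)) (d : ℕ) where
  open BoundedPaths _≟_ (allFin N) ψ ψ?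

  Check : Set
  Check = ∀ x y → D x → D y → Within d x y

  check? : Dec Check
  check? = FinP.all? (λ x → FinP.all? (λ y → D? x →-dec (D? y →-dec within? d x y)))

  sound : Check → ∀ x y → D x → D y → Star ψ x y
  sound check x y x∈D y∈D = within⇒star d (check x y x∈D y∈D)

module _ {n m k : ℕ} where
  private
    T : Set
    T = Triple {n} {m} {k}

  _≟T_ : DecidableEquality T
  _≟T_ = ≡-dec _≟_ (≡-dec _≟_ _≟_)

  open import Data.List.Membership.DecPropositional _≟T_ public using (_∈?_)

  Agree₂ : T → T → Set
  Agree₂ (r , c , s) (r' , c' , s') = (r ≡ r' × c ≡ c') ⊎ (r ≡ r' × s ≡ s') ⊎ (c ≡ c' × s ≡ s')

  PLSCheck : List T → Set
  PLSCheck P = Unique P × All (λ t → All (λ u → Agree₂ t u → t ≡ u) P) P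

  pls? : ∀ P → Dec (PLSCheck P)
  pls? P = allPairs? (λ t u → ¬? (t ≟T u)) P ×-dec all? (λ t → all? (λ u → agree? t u →-dec (t ≟T u)) P) P
    where
    agree? : ∀ t u → Dec (Agree₂ t u)
    agree? (r , c , s) (r' , c' , s') =
      ((r ≟ r') ×-dec (c ≟ c')) ⊎-dec ((r ≟ r') ×-dec (s ≟ s')) ⊎-dec ((c ≟ c') ×-dec (s ≟ s'))

  checked-pls : ∀ {P} → PLSCheck P → IsPLS P
  checked-pls (unique , agree) = unique , λ t∈ u∈ same → lookup (lookup agree t∈) u∈ same

  MatesAt : List T → T → Set
  MatesAt Y (r , c , s) =
    (∃[ r' ] (r' ≢ r × (r' , c , s) ∈ Y × (∀ r'' → r'' ≢ r → (r'' , c , s) ∈ Y → r'' ≡ r'))) ×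
    (∃[ c' ] (c' ≢ c × (r , c' , s) ∈ Y × (∀ c'' → c'' ≢ c → (r , c'' , s) ∈ Y → c'' ≡ c'))) ×
    (∃[ s' ] (s' ≢ s × (r , c , s') ∈ Y × (∀ s'' → s'' ≢ s → (r , c , s'') ∈ Y → s'' ≡ s')))

  matesAt? : ∀ Y t → Dec (MatesAt Y t)
  matesAt? Y (r , c , s) =
    FinP.any? (λ r' → ¬? (r' ≟ r) ×-dec ((r' , c , s) ∈? Y) ×-dec
      FinP.all? (λ r'' → ¬? (r'' ≟ r) →-dec ((r'' , c , s) ∈? Y) →-dec (r'' ≟ r'))) ×-dec
    FinP.any? (λ c' → ¬? (c' ≟ c) ×-dec ((r , c' , s) ∈? Y) ×-dec
      FinP.all? (λ c'' → ¬? (c'' ≟ c) →-dec ((r , c'' , s) ∈? Y) →-dec (c'' ≟ c'))) ×-dec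
    FinP.any? (λ s' → ¬? (s' ≟ s) ×-dec ((r , c , s') ∈? Y) ×-dec
      FinP.all? (λ s'' → ¬? (s'' ≟ s) →-dec ((r , c , s'') ∈? Y) →-dec (s'' ≟ s')))

  mates? : ∀ X Y → Dec (All (MatesAt Y) X)
  mates? X Y = all? (matesAt? Y) X

  checked-mates : ∀ {X Y} → All (MatesAt Y) X → Mates X Y
  checked-mates ok t∈ = lookup ok t∈

  oneDiff? : ∀ (t u : T) → Dec (OneDiff t u)
  oneDiff? (r , c , s) (r' , c' , s') =
    (¬? (r' ≟ r) ×-dec (c' ≟ c) ×-dec (s' ≟ s)) ⊎-dec
    ((r' ≟ r) ×-dec ¬? (c' ≟ c) ×-dec (s' ≟ s)) ⊎-dec
    ((r' ≟ r) ×-dec (c' ≟ c) ×-dec ¬? (s' ≟ s))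

  linked? : ∀ (W B : List T) t t' → Dec (Linked W B t t')
  linked? W B t t' = (t ∈? W) ×-dec (t' ∈? W) ×-dec
    map′ find (λ (u , u∈ , diffs) → lose u∈ diffs) (any? (λ u → oneDiff? t u ×-dec oneDiff? u t') B)

  module _ (W B : List T) (d : ℕ) where
    module RowCheck (r : Fin n) = SingleCycleCheck (λ s → ∃[ c ] ((r , c , s) ∈ W))
      (λ s → FinP.any? (λ c → (r , c , s) ∈? W)) (ψrow W B r)
      (λ s s' → FinP.any? (λ c → ((r , c , s) ∈? W) ×-dec ((r , c , s') ∈? B))) d
    module ColumnCheck (c : Fin m) = SingleCycleCheck (λ s → ∃[ r ] ((r , c , s) ∈ W))
      (λ s → FinP.any? (λ r → (r , c , s) ∈? W)) (ψcol W B c)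
      (λ s s' → FinP.any? (λ r → ((r , c , s) ∈? W) ×-dec ((r , c , s') ∈? B))) d
    module SymbolCheck (s : Fin k) = SingleCycleCheck (λ r → ∃[ c ] ((r , c , s) ∈ W))
      (λ r → FinP.any? (λ c → (r , c , s) ∈? W)) (ψsym W B s)
      (λ r r' → FinP.any? (λ c → ((r , c , s) ∈? W) ×-dec ((r' , c , s) ∈? B))) d

    SeparatedCheck : Set
    SeparatedCheck = (∀ r → RowCheck.Check r) × (∀ c → ColumnCheck.Check c) × (∀ s → SymbolCheck.Check s)

    separated? : Dec SeparatedCheck
    separated? = FinP.all? RowCheck.check? ×-dec FinP.all? ColumnCheck.check? ×-dec FinP.all? SymbolCheck.check?

    checked-separated : SeparatedCheck → Separated W B
    checked-separated (rows , columns , symbols) =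
      (λ r → RowCheck.sound r (rows r)) , (λ c → ColumnCheck.sound c (columns c)) ,
      (λ s → SymbolCheck.sound s (symbols s))

    open BoundedPaths _≟T_ W (Linked W B) (linked? W B)

    ConnectedCheck : T → Set
    ConnectedCheck t₀ = All (Within d t₀) W

    connected? : ∀ t₀ → Dec (ConnectedCheck t₀)
    connected? t₀ = all? (within? d t₀) W

    checked-connected : Mates W B → Mates B W → ∀ {t₀} → ConnectedCheck t₀ → Connected W B
    checked-connected mWB mBW {t₀} check =
      connected-from-hub mWB mBW t₀ (λ t∈ → within⇒star d (lookup check t∈))

-- A genus-one trade on 3 rows, 4 columns and 4 symbols (11 cells):
--        W                B
--     0 1 2 3          2 0 3 1
--     1 2 0 ·          0 1 2 ·
--     2 0 3 1          1 2 0 3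
-- All bitrade properties are checked by evaluation; 2·1 + 3 + 4 + 4 = 2 + 11
-- gives genus 1.
T₁ : Set
T₁ = Triple {3} {4} {4}

W₁ B₁ : List T₁
W₁ = (0F , 0F , 0F) ∷ (0F , 1F , 1F) ∷ (0F , 2F , 2F) ∷ (0F , 3F , 3F) ∷
     (1F , 0F , 1F) ∷ (1F , 1F , 2F) ∷ (1F , 2F , 0F) ∷
     (2F , 0F , 2F) ∷ (2F , 1F , 0F) ∷ (2F , 2F , 3F) ∷ (2F , 3F , 1F) ∷ []
B₁ = (0F , 0F , 2F) ∷ (0F , 1F , 0F) ∷ (0F , 2F , 3F) ∷ (0F , 3F , 1F) ∷
     (1F , 0F , 0F) ∷ (1F , 1F , 1F) ∷ (1F , 2F , 2F) ∷
     (2F , 0F , 1F) ∷ (2F , 1F , 2F) ∷ (2F , 2F , 0F) ∷ (2F , 3F , 3F) ∷ []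

matesWB₁ : Mates W₁ B₁
matesWB₁ = checked-mates (from-yes (mates? W₁ B₁))

matesBW₁ : Mates B₁ W₁
matesBW₁ = checked-mates (from-yes (mates? B₁ W₁))

genus₁ : HasGenus W₁ 1
genus₁ = B₁ , bitrade , checked-separated W₁ B₁ 3 (from-yes (separated? W₁ B₁ 3)) ,
         checked-connected W₁ B₁ 2 matesWB₁ matesBW₁ (from-yes (connected? W₁ B₁ 2 (0F , 0F , 0F))) , refl
  where
  bitrade : IsBitrade W₁ B₁
  bitrade = (_ , here refl) , (_ , here refl) , checked-pls (from-yes (pls? W₁)) , checked-pls (from-yes (pls? B₁)) ,
            matesWB₁ , matesBW₁

-- Rows 0, 1 agree in symbol 1 at columns 1, 0 and in symbol 0 at columns
-- 0, 2; rows 1, 2 agree in symbol 2 at columns 1, 0; but cells (1, 0) and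
-- (2, 2) carry the different symbols 1 and 3.
violation₁ : QuadrangleViolation W₁
violation₁ = record
  { cell₁₁ = from-yes ((0F , 1F , 1F) ∈? W₁) ; cell₂₂ = from-yes ((1F , 0F , 1F) ∈? W₁)
  ; cell₁₃ = from-yes ((0F , 0F , 0F) ∈? W₁) ; cell₂₄ = from-yes ((1F , 2F , 0F) ∈? W₁)
  ; cell₃₁ = from-yes ((1F , 1F , 2F) ∈? W₁) ; cell₄₂ = from-yes ((2F , 0F , 2F) ∈? W₁)
  ; cell₃₃ = from-yes ((1F , 0F , 1F) ∈? W₁) ; cell₄₄ = from-yes ((2F , 2F , 3F) ∈? W₁)
  ; s₄≢s₅ = λ () }

cyclicEmbeddable : ∀ h → CyclicEmbeddableTrade (suc h)
cyclicEmbeddable h = record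
  { n = 3 ; m = C.m ; k = C.m ; W = C.W ; genus = C.hasGenus C.g C.odd
  ; G = ZMod.ℤ/m C.m ; cyclic = ZMod.ℤ/m-cyclic C.m ; embedding = C.embeds }
  where module C = CyclicTrade h

nonEmbeddable : ∀ h → NonEmbeddableTrade (suc h)
nonEmbeddable zero = record
  { n = 3 ; m = 4 ; k = 4 ; W = W₁ ; genus = genus₁ ; noEmbedding = violation⇒¬embeds violation₁ }
nonEmbeddable (suc h) = record
  { n = 3 ; m = T.m ; k = T.m ; W = T.W ; genus = T.hasGenus T.g T.odd
  ; noEmbedding = violation⇒¬embeds T.violation }
  where module T = TwistedTrade h

theorem1p1 : (g : ℕ) → g ≥ 1 → Theorem1p1Conclusion g
theorem1p1 (suc h) _ = record { nonEmbeddable = nonEmbeddable h ; cyclicEmbeddable = cyclicEmbeddable h }
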